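{- sBIL is finitely algebraizable with respect to $\mathcal{BHA}$ with defining equations $\tau(x)=\{x=\top\}$ and equivalence formulas $\Delta(x,y)=\{x\leftrightarrow y\}$; that is, for all sets of formulas $\Gamma\cup\{\phi\}$ and all sets of equations $\Theta\cup\{\epsilon=\delta\}$: (ALG1) $\Gamma\vdash_s\phi$ iff $\tau(\Gamma)\models_{\mathcal{BHA}}\tau(\phi)$; (ALG2) $\Theta\models_{\mathcal{BHA}}\epsilon=\delta$ iff $\Delta(\Theta)\vdash_s\Delta(\epsilon,\delta)$; (ALG3) $\phi\vdash_s\Delta(\tau(\phi))$ and $\Delta(\tau(\phi))\vdash_s\phi$; (ALG4) $\epsilon=\delta\models_{\mathcal{BHA}}\tau(\Delta(\epsilon,\delta))$ and $\tau(\Delta(\epsilon,\delta))\models_{\mathcal{BHA}}\epsilon=\delta$.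
   Context: Fix a countably infinite set $\mathrm{Prop}$ of propositional variables. Bi-intuitionistic formulas are generated by $\phi ::= p \mid \bot \mid \top \mid \phi\wedge\phi \mid \phi\vee\phi \mid \phi\to\phi \mid \phi\prec\phi$ with $p\in\mathrm{Prop}$, where $\prec$ is the binary exclusion connective. Abbreviations: $\neg\phi := \phi\to\bot$, ${\sim}\phi := \top\prec\phi$, $\phi\leftrightarrow\psi := (\phi\to\psi)\wedge(\psi\to\phi)$. An axiom is any instance of: (A1) $\phi\to(\psi\to\phi)$; (A2) $(\phi\to(\psi\to\chi))\to((\phi\to\psi)\to(\phi\to\chi))$; (A3) $\phi\to(\phi\vee\psi)$; (A4) $\psi\to(\phi\vee\psi)$; (A5) $(\phi\to\chi)\to((\psi\to\chi)\to((\phi\vee\psi)\to\chi))$; (A6) $(\phi\wedge\psi)\to\phi$; (A7) $(\phi\wedge\psi)\to\psi$; (A8) $(\chi\to\phi)\to((\chi\to\psi)\to(\chi\to(\phi\wedge\psi)))$; (A9) $\bot\to\phi$; (A10) $\phi\to\top$; (A11) $\phi\to(\psi\vee(\phi\prec\psi))$; (A12) $(\phi\prec\psi)\to{\sim}(\phi\to\psi)$; (A13) $((\phi\prec\psi)\prec\chi)\to(\phi\prec(\psi\vee\chi))$; (A14) $\neg(\phi\prec\psi)\to(\phi\to\psi)$. The logic sBIL is the relation $\Gamma\vdash_s\phi$ that holds iff $\Gamma\vdash\phi$ is derivable with the rules: (Ax) $\Gamma\vdash\phi$ for any axiom $\phi$; (El) $\Gamma\vdash\phi$ if $\phi\in\Gamma$;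 (MP) from $\Gamma\vdash\phi$ and $\Gamma\vdash\phi\to\psi$ infer $\Gamma\vdash\psi$; (sDN) from $\Gamma\vdash\phi$ infer $\Gamma\vdash\neg{\sim}\phi$. For sets, $\Gamma\vdash_s\Delta$ means $\Gamma\vdash_s\delta$ for every $\delta\in\Delta$. A bi-Heyting algebra is an algebra $(A,\top,\bot,\wedge,\vee,\to,\prec)$ such that $(A,\top,\bot,\wedge,\vee)$ is a bounded lattice with order $a\le b$ iff $a=a\wedge b$, and for all $a,b,c$: $a\wedge b\le c\iff a\le b\to c$, and $a\le b\vee c\iff a\prec b\le c$. $\mathcal{BHA}$ is the class of all bi-Heyting algebras. A valuation $v:\mathrm{Prop}\to A$ extends to $\bar v$ on formulas by interpreting connectives as the corresponding operations. An equation is a pair of formulas written $\phi=\psi$; for a class $K$ of algebras and set of equations $\Theta$, $\Theta\models_K\phi=\psi$ means: for all $A\in K$ and valuations $v$ on $A$, if $\bar v(\theta)=\bar v(\eta)$ for all $(\theta=\eta)\in\Theta$ then $\bar v(\phi)=\bar v(\psi)$; for a set of equations on the right, $\models_K$ means each is entailed. Notation: $\tau(\phi)$ is $\tau(x)$ with $x$ replaced by $\phi$, $\tau(\Gamma)=\bigcup_{\gamma\in\Gamma}\tau(\gamma)$; $\Delta(\epsilon,\delta)$ is $\Delta(x,y)$ with $x,y$ replaced by $\epsilon,\delta$; $\Delta(\Theta)=\bigcup\{\Delta(\epsilon,\delta)\mid(\epsilon=\delta)\in\Theta\}$. -}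

module Defs where

open import Level using (Level; _⊔_) renaming (suc to lsuc; zero to lzero)
open import Data.Nat using (ℕ)
open import Data.Product using (Σ; ∃; _×_; _,_)
open import Relation.Binary.PropositionalEquality using (_≡_)
open import Relation.Binary.Core using (Rel)
open import Algebra.Core using (Op₂)
open import Algebra.Definitions using (Congruent₂)
open import Algebra.Lattice.Structures using (IsLattice)
open import Function.Bundles using (_⇔_)

Prop : Set
Prop = ℕ

infixr 20 _⇒_
infixl 25 _⋎_
infixl 30 _⋏_
infixl 22 _≺_

data Formula : Set where
  var  : Prop → Formula
  ⊥f   : Formula
  ⊤f   : Formula
  _⋏_  : Formula → Formula → Formula
  _⋎_  : Formula → Formula → Formula
  _⇒_  : Formula → Formula → Formula
  _≺_  : Formula → Formula → Formula

¬f_ : Formula → Formula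
¬f φ = φ ⇒ ⊥f

∼f_ : Formula → Formula
∼f φ = ⊤f ≺ φ

_⇔f_ : Formula → Formula → Formula
φ ⇔f ψ = (φ ⇒ ψ) ⋏ (ψ ⇒ φ)

data Axiom : Formula → Set where
  A1  : ∀ φ ψ → Axiom (φ ⇒ (ψ ⇒ φ))
  A2  : ∀ φ ψ χ → Axiom ((φ ⇒ (ψ ⇒ χ)) ⇒ ((φ ⇒ ψ) ⇒ (φ ⇒ χ)))
  A3  : ∀ φ ψ → Axiom (φ ⇒ (φ ⋎ ψ))
  A4  : ∀ φ ψ → Axiom (ψ ⇒ (φ ⋎ ψ))
  A5  : ∀ φ ψ χ → Axiom ((φ ⇒ χ) ⇒ ((ψ ⇒ χ) ⇒ ((φ ⋎ ψ) ⇒ χ)))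
  A6  : ∀ φ ψ → Axiom ((φ ⋏ ψ) ⇒ φ)
  A7  : ∀ φ ψ → Axiom ((φ ⋏ ψ) ⇒ ψ)
  A8  : ∀ φ ψ χ → Axiom ((χ ⇒ φ) ⇒ ((χ ⇒ ψ) ⇒ (χ ⇒ (φ ⋏ ψ))))
  A9  : ∀ φ → Axiom (⊥f ⇒ φ)
  A10 : ∀ φ → Axiom (φ ⇒ ⊤f)
  A11 : ∀ φ ψ → Axiom (φ ⇒ (ψ ⋎ (φ ≺ ψ)))
  A12 : ∀ φ ψ → Axiom ((φ ≺ ψ) ⇒ (∼f (φ ⇒ ψ)))
  A13 : ∀ φ ψ χ → Axiom (((φ ≺ ψ) ≺ χ) ⇒ (φ ≺ (ψ ⋎ χ)))
  A14 : ∀ φ ψ → Axiom ((¬f (φ ≺ ψ)) ⇒ (φ ⇒ ψ))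

FSet : Set₁
FSet = Formula → Set

⟨_⟩ : Formula → FSet
⟨ φ ⟩ ψ = ψ ≡ φ

infix 4 _⊢s_ _⊢S_

data _⊢s_ (Γ : FSet) : Formula → Set where
  ax  : ∀ {φ} → Axiom φ → Γ ⊢s φ
  el  : ∀ {φ} → Γ φ → Γ ⊢s φ
  mp  : ∀ {φ ψ} → Γ ⊢s φ → Γ ⊢s (φ ⇒ ψ) → Γ ⊢s ψ
  sdn : ∀ {φ} → Γ ⊢s φ → Γ ⊢s (¬f (∼f φ))

_⊢S_ : FSet → FSet → Set
Γ ⊢S Δ = ∀ δ → Δ δ → Γ ⊢s δ

record BHA (c ℓ : Level) : Set (lsuc (c ⊔ ℓ)) where
  infix 4 _≈_ _≤_
  field
    Carrier : Set c
    _≈_     : Rel Carrier ℓ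
    ⊤ ⊥     : Carrier
    _∧_ _∨_ _⇨_ _⊸_ : Op₂ Carrier
    isLattice : IsLattice _≈_ _∨_ _∧_
    ⇨-cong    : Congruent₂ _≈_ _⇨_
    ⊸-cong    : Congruent₂ _≈_ _⊸_

  _≤_ : Rel Carrier ℓ
  a ≤ b = a ≈ (a ∧ b)

  field
    ⊤-max : ∀ a → a ≤ ⊤
    ⊥-min : ∀ a → ⊥ ≤ a
    ⇨-residual : ∀ a b c → (a ∧ b ≤ c) ⇔ (a ≤ b ⇨ c)
    ⊸-residual : ∀ a b c → (a ≤ b ∨ c) ⇔ (a ⊸ b ≤ c)

module _ {c ℓ : Level} (A : BHA c ℓ) where
  open BHA A

  ⟦_⟧ : Formula → (Prop → Carrier) → Carrier
  ⟦ var p ⟧ v = v p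
  ⟦ ⊥f ⟧ v = ⊥
  ⟦ ⊤f ⟧ v = ⊤
  ⟦ φ ⋏ ψ ⟧ v = ⟦ φ ⟧ v ∧ ⟦ ψ ⟧ v
  ⟦ φ ⋎ ψ ⟧ v = ⟦ φ ⟧ v ∨ ⟦ ψ ⟧ v
  ⟦ φ ⇒ ψ ⟧ v = ⟦ φ ⟧ v ⇨ ⟦ ψ ⟧ v
  ⟦ φ ≺ ψ ⟧ v = ⟦ φ ⟧ v ⊸ ⟦ ψ ⟧ v

Equation : Set
Equation = Formula × Formula    -- (φ , ψ) stands for φ = ψ

ESet : Set₁
ESet = Equation → Set

⟨_⟩ₑ : Equation → ESet
⟨ e ⟩ₑ e' = e' ≡ e

_⊨[_,_]_ : ESet → (c ℓ : Level) → Equation → Set (lsuc (c ⊔ ℓ))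
Θ ⊨[ c , ℓ ] (φ , ψ) =
  (A : BHA c ℓ) (v : Prop → BHA.Carrier A) →
  (∀ θ η → Θ (θ , η) → BHA._≈_ A (⟦ A ⟧ θ v) (⟦ A ⟧ η v)) →
  BHA._≈_ A (⟦ A ⟧ φ v) (⟦ A ⟧ ψ v)

_⊨S[_,_]_ : ESet → (c ℓ : Level) → ESet → Set (lsuc (c ⊔ ℓ))
Θ ⊨S[ c , ℓ ] Ξ = ∀ e → Ξ e → Θ ⊨[ c , ℓ ] e

τ : Formula → ESet
τ φ = ⟨ (φ , ⊤f) ⟩ₑ

τS : FSet → ESet
τS Γ e = Σ Formula λ γ → Γ γ × τ γ e

Δ : Formula → Formula → FSet
Δ ε δ = ⟨ ε ⇔f δ ⟩

ΔS : ESet → FSet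
ΔS Θ ψ = Σ Equation λ { (ε , δ) → Θ (ε , δ) × Δ ε δ ψ }

-- Soundness: every axiom evaluates to ⊤ in a bi-Heyting algebra, modus ponens
-- preserves ⊤, and so does sDN because ⊤ ⊸ ⊤ = ⊥.  Completeness: formulas modulo
-- Γ-provable equivalence form a bi-Heyting algebra (the Lindenbaum algebra of Γ)
-- in which the canonical valuation makes exactly the Γ-theorems equal to ⊤.
-- The remaining clauses follow because, in every bi-Heyting algebra, x = y holds
-- iff (x ⇨ y) ∧ (y ⇨ x) = ⊤.
module Submission where

open import Defs
open import Level using (Level; Lift; lift; lower)
open import Data.List using (List; []; _∷_; [_])
open import Data.List.Membership.Propositional using (_∈_)
open import Data.List.Relation.Unary.Any using (here; there)
open import Data.Product using (_×_; _,_)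
open import Relation.Binary.PropositionalEquality using (_≡_; refl; sym; cong₂; subst₂)
open import Algebra.Lattice.Bundles using (Lattice)
open import Algebra.Lattice.Structures using (module IsLattice)
import Algebra.Lattice.Properties.Lattice as LatticeProperties
import Relation.Binary.Lattice as OrderLattice
open import Function.Bundles using (_⇔_; mk⇔; Equivalence)
open import Function.Properties.Equivalence using () renaming (sym to ⇔-sym; trans to ⇔-trans)

open Equivalence using (to; from)

variable
  Γ : FSet
  L : List Formula
  φ φ' ψ ψ' χ : Formula

infix  4 _⨾_⊢_
infixl 5 _·_
infix  6 ƛ_

-- Γ ⨾ L ⊢ φ: derivations from Γ with local hypotheses L.  sDN is available only
-- inside closed derivations (glob), which is what lets ƛ_ discharge hypotheses.
data _⨾_⊢_ (Γ : FSet) (L : List Formula) : Formula → Set where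
  hyp  : φ ∈ L → Γ ⨾ L ⊢ φ
  glob : Γ ⊢s φ → Γ ⨾ L ⊢ φ
  _·_  : Γ ⨾ L ⊢ φ ⇒ ψ → Γ ⨾ L ⊢ φ → Γ ⨾ L ⊢ ψ

axiom : Axiom φ → Γ ⨾ L ⊢ φ
axiom a = glob (ax a)

⇒-refl : Γ ⊢s φ ⇒ φ
⇒-refl {φ = φ} = mp (ax (A1 φ φ)) (mp (ax (A1 φ (φ ⇒ φ))) (ax (A2 φ (φ ⇒ φ) φ)))

ƛ_ : Γ ⨾ φ ∷ L ⊢ ψ → Γ ⨾ L ⊢ φ ⇒ ψ
ƛ hyp (here refl) = glob ⇒-refl
ƛ hyp (there p)   = axiom (A1 _ _) · hyp p
ƛ glob d          = axiom (A1 _ _) · glob d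
ƛ (d · e)         = axiom (A2 _ _ _) · ƛ d · ƛ e

close : Γ ⨾ [] ⊢ φ → Γ ⊢s φ
close (glob d) = d
close (d · e)  = mp (close e) (close d)

#0 : Γ ⨾ φ ∷ L ⊢ φ
#0 = hyp (here refl)

#1 : Γ ⨾ ψ ∷ φ ∷ L ⊢ φ
#1 = hyp (there (here refl))

⊤f-intro : Γ ⨾ L ⊢ ⊤f
⊤f-intro = axiom (A10 (⊤f ⇒ ⊤f)) · glob ⇒-refl

⊥f-elim : Γ ⨾ L ⊢ ⊥f → Γ ⨾ L ⊢ φ
⊥f-elim d = axiom (A9 _) · d

⋏-intro : Γ ⨾ L ⊢ φ → Γ ⨾ L ⊢ ψ → Γ ⨾ L ⊢ φ ⋏ ψ
⋏-intro {φ = φ} {ψ = ψ} d e =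
  axiom (A8 φ ψ ⊤f) · (axiom (A1 _ _) · d) · (axiom (A1 _ _) · e) · ⊤f-intro

⋏-elimˡ : Γ ⨾ L ⊢ φ ⋏ ψ → Γ ⨾ L ⊢ φ
⋏-elimˡ d = axiom (A6 _ _) · d

⋏-elimʳ : Γ ⨾ L ⊢ φ ⋏ ψ → Γ ⨾ L ⊢ ψ
⋏-elimʳ d = axiom (A7 _ _) · d

⋎-introˡ : Γ ⨾ L ⊢ φ → Γ ⨾ L ⊢ φ ⋎ ψ
⋎-introˡ d = axiom (A3 _ _) · d

⋎-introʳ : Γ ⨾ L ⊢ ψ → Γ ⨾ L ⊢ φ ⋎ ψ
⋎-introʳ d = axiom (A4 _ _) · d

⋎-elim : Γ ⨾ L ⊢ φ ⋎ ψ → Γ ⨾ φ ∷ L ⊢ χ → Γ ⨾ ψ ∷ L ⊢ χ → Γ ⨾ L ⊢ χ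
⋎-elim d e f = axiom (A5 _ _ _) · ƛ e · ƛ f · d

⇔f-intro : Γ ⨾ [ φ ] ⊢ ψ → Γ ⨾ [ ψ ] ⊢ φ → Γ ⊢s (φ ⇔f ψ)
⇔f-intro d e = close (⋏-intro (ƛ d) (ƛ e))

⇔f-to : Γ ⊢s (φ ⇔f ψ) → Γ ⨾ L ⊢ φ ⇒ ψ
⇔f-to d = ⋏-elimˡ (glob d)

⇔f-from : Γ ⊢s (φ ⇔f ψ) → Γ ⨾ L ⊢ ψ ⇒ φ
⇔f-from d = ⋏-elimʳ (glob d)

⊢⇔⊢⇔⊤f : (Γ ⊢s φ) ⇔ (Γ ⊢s (φ ⇔f ⊤f))
⊢⇔⊢⇔⊤f = mk⇔ (λ d → ⇔f-intro ⊤f-intro (glob d)) (λ d → close (⇔f-from d · ⊤f-intro))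

⊢⇒⇒⊢¬≺ : Γ ⊢s φ ⇒ ψ → Γ ⊢s ¬f (φ ≺ ψ)
⊢⇒⇒⊢¬≺ d = close (ƛ (glob (sdn d) · (axiom (A12 _ _) · #0)))

≺-residual-to : Γ ⊢s φ ⇒ ψ ⋎ χ → Γ ⊢s φ ≺ ψ ⇒ χ
≺-residual-to d = close (ƛ ⋎-elim (axiom (A11 _ _) · #0) #0
  (⊥f-elim (glob (⊢⇒⇒⊢¬≺ d) · (axiom (A13 _ _ _) · #0))))

≺-residual-from : Γ ⊢s φ ≺ ψ ⇒ χ → Γ ⊢s φ ⇒ ψ ⋎ χ
≺-residual-from d = close (ƛ ⋎-elim (axiom (A11 _ _) · #0) (⋎-introˡ #0) (⋎-introʳ (glob d · #0)))

≺-mono : Γ ⊢s φ ⇒ φ' → Γ ⊢s ψ' ⇒ ψ → Γ ⊢s φ ≺ ψ ⇒ φ' ≺ ψ'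
≺-mono d e = ≺-residual-to (close (ƛ ⋎-elim (axiom (A11 _ _) · (glob d · #0))
  (⋎-introˡ (glob e · #0)) (⋎-introʳ #0)))

module ProvableEquivalence (Γ : FSet) where

  infix 4 _≋_

  _≋_ : Formula → Formula → Set
  φ ≋ ψ = Γ ⊢s (φ ⇔f ψ)

  ≋-refl : φ ≋ φ
  ≋-refl = ⇔f-intro #0 #0

  ≋-sym : φ ≋ ψ → ψ ≋ φ
  ≋-sym d = ⇔f-intro (⇔f-from d · #0) (⇔f-to d · #0)

  ≋-trans : φ ≋ ψ → ψ ≋ χ → φ ≋ χ
  ≋-trans d e = ⇔f-intro (⇔f-to e · (⇔f-to d · #0)) (⇔f-from d · (⇔f-from e · #0))

  ⋏-cong : φ ≋ φ' → ψ ≋ ψ' → φ ⋏ ψ ≋ φ' ⋏ ψ'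
  ⋏-cong d e = ⇔f-intro (⋏-intro (⇔f-to d · ⋏-elimˡ #0) (⇔f-to e · ⋏-elimʳ #0))
                        (⋏-intro (⇔f-from d · ⋏-elimˡ #0) (⇔f-from e · ⋏-elimʳ #0))

  ⋎-cong : φ ≋ φ' → ψ ≋ ψ' → φ ⋎ ψ ≋ φ' ⋎ ψ'
  ⋎-cong d e = ⇔f-intro (⋎-elim #0 (⋎-introˡ (⇔f-to d · #0)) (⋎-introʳ (⇔f-to e · #0)))
                        (⋎-elim #0 (⋎-introˡ (⇔f-from d · #0)) (⋎-introʳ (⇔f-from e · #0)))

  ⇒-cong : φ ≋ φ' → ψ ≋ ψ' → (φ ⇒ ψ) ≋ (φ' ⇒ ψ')
  ⇒-cong d e = ⇔f-intro (ƛ (⇔f-to e · (#1 · (⇔f-from d · #0))))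
                        (ƛ (⇔f-from e · (#1 · (⇔f-to d · #0))))

  ≺-cong : φ ≋ φ' → ψ ≋ ψ' → φ ≺ ψ ≋ φ' ≺ ψ'
  ≺-cong d e = close (⋏-intro (glob (≺-mono (close (⇔f-to d)) (close (⇔f-from e))))
                              (glob (≺-mono (close (⇔f-from d)) (close (⇔f-to e)))))

  ≋⋏⇔⊢⇒ : (φ ≋ φ ⋏ ψ) ⇔ (Γ ⊢s φ ⇒ ψ)
  ≋⋏⇔⊢⇒ = mk⇔ (λ d → close (ƛ ⋏-elimʳ (⇔f-to d · #0)))
               (λ d → ⇔f-intro (⋏-intro #0 (glob d · #0)) (⋏-elimˡ #0))

module Lindenbaum (Γ : FSet) (c ℓ : Level) where

  open ProvableEquivalence Γ

  algebra : BHA c ℓ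
  algebra = record
    { Carrier = Lift c Formula
    ; _≈_ = λ x y → Lift ℓ (lower x ≋ lower y)
    ; ⊤ = lift ⊤f
    ; ⊥ = lift ⊥f
    ; _∧_ = λ x y → lift (lower x ⋏ lower y)
    ; _∨_ = λ x y → lift (lower x ⋎ lower y)
    ; _⇨_ = λ x y → lift (lower x ⇒ lower y)
    ; _⊸_ = λ x y → lift (lower x ≺ lower y)
    ; isLattice = record
      { isEquivalence = record
        { refl  = lift ≋-refl
        ; sym   = λ d → lift (≋-sym (lower d))
        ; trans = λ d e → lift (≋-trans (lower d) (lower e))
        }
      ; ∨-comm = λ _ _ → lift (⇔f-intro (⋎-elim #0 (⋎-introʳ #0) (⋎-introˡ #0))
                                        (⋎-elim #0 (⋎-introʳ #0) (⋎-introˡ #0)))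
      ; ∨-assoc = λ _ _ _ → lift (⇔f-intro
          (⋎-elim #0 (⋎-elim #0 (⋎-introˡ #0) (⋎-introʳ (⋎-introˡ #0))) (⋎-introʳ (⋎-introʳ #0)))
          (⋎-elim #0 (⋎-introˡ (⋎-introˡ #0)) (⋎-elim #0 (⋎-introˡ (⋎-introʳ #0)) (⋎-introʳ #0))))
      ; ∨-cong = λ d e → lift (⋎-cong (lower d) (lower e))
      ; ∧-comm = λ _ _ → lift (⇔f-intro (⋏-intro (⋏-elimʳ #0) (⋏-elimˡ #0))
                                        (⋏-intro (⋏-elimʳ #0) (⋏-elimˡ #0)))
      ; ∧-assoc = λ _ _ _ → lift (⇔f-intro
          (⋏-intro (⋏-elimˡ (⋏-elimˡ #0)) (⋏-intro (⋏-elimʳ (⋏-elimˡ #0)) (⋏-elimʳ #0)))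
          (⋏-intro (⋏-intro (⋏-elimˡ #0) (⋏-elimˡ (⋏-elimʳ #0))) (⋏-elimʳ (⋏-elimʳ #0))))
      ; ∧-cong = λ d e → lift (⋏-cong (lower d) (lower e))
      ; absorptive = (λ _ _ → lift (⇔f-intro (⋎-elim #0 #0 (⋏-elimˡ #0)) (⋎-introˡ #0)))
                   , (λ _ _ → lift (⇔f-intro (⋏-elimˡ #0) (⋏-intro #0 (⋎-introˡ #0))))
      }
    ; ⇨-cong = λ d e → lift (⇒-cong (lower d) (lower e))
    ; ⊸-cong = λ d e → lift (≺-cong (lower d) (lower e))
    ; ⊤-max = λ _ → lift (from ≋⋏⇔⊢⇒ (close (ƛ ⊤f-intro)))
    ; ⊥-min = λ _ → lift (from ≋⋏⇔⊢⇒ (close (ƛ ⊥f-elim #0)))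
    ; ⇨-residual = λ _ _ _ → mk⇔
        (λ d → lift (from ≋⋏⇔⊢⇒ (close (ƛ ƛ (glob (to ≋⋏⇔⊢⇒ (lower d)) · ⋏-intro #1 #0)))))
        (λ d → lift (from ≋⋏⇔⊢⇒ (close (ƛ (glob (to ≋⋏⇔⊢⇒ (lower d)) · ⋏-elimˡ #0 · ⋏-elimʳ #0)))))
    ; ⊸-residual = λ _ _ _ → mk⇔
        (λ d → lift (from ≋⋏⇔⊢⇒ (≺-residual-to (to ≋⋏⇔⊢⇒ (lower d)))))
        (λ d → lift (from ≋⋏⇔⊢⇒ (≺-residual-from (to ≋⋏⇔⊢⇒ (lower d)))))
    }

  open BHA algebra using (_≈_)

  canonical : Prop → Lift c Formula
  canonical p = lift (var p)

  ⟦⟧-canonical : ∀ φ → lower (⟦ algebra ⟧ φ canonical) ≡ φ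
  ⟦⟧-canonical (var p) = refl
  ⟦⟧-canonical ⊥f      = refl
  ⟦⟧-canonical ⊤f      = refl
  ⟦⟧-canonical (φ ⋏ ψ) = cong₂ _⋏_ (⟦⟧-canonical φ) (⟦⟧-canonical ψ)
  ⟦⟧-canonical (φ ⋎ ψ) = cong₂ _⋎_ (⟦⟧-canonical φ) (⟦⟧-canonical ψ)
  ⟦⟧-canonical (φ ⇒ ψ) = cong₂ _⇒_ (⟦⟧-canonical φ) (⟦⟧-canonical ψ)
  ⟦⟧-canonical (φ ≺ ψ) = cong₂ _≺_ (⟦⟧-canonical φ) (⟦⟧-canonical ψ)

  canonical-≈⇔≋ : (⟦ algebra ⟧ φ canonical ≈ ⟦ algebra ⟧ ψ canonical) ⇔ (φ ≋ ψ)
  canonical-≈⇔≋ {φ} {ψ} = mk⇔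
    (λ d → subst₂ _≋_ (⟦⟧-canonical φ) (⟦⟧-canonical ψ) (lower d))
    (λ d → lift (subst₂ _≋_ (sym (⟦⟧-canonical φ)) (sym (⟦⟧-canonical ψ)) d))

module Semantics {c ℓ : Level} (A : BHA c ℓ) where

  open BHA A
  open IsLattice isLattice using () renaming (sym to ≈-sym)

  lattice : Lattice c ℓ
  lattice = record { isLattice = isLattice }

  open OrderLattice.IsLattice (LatticeProperties.∨-∧-isOrderTheoreticLattice lattice)
    using (x≤x∨y; y≤x∨y; ∨-least; x∧y≤x; x∧y≤y; ∧-greatest)
    renaming (refl to ≤-refl; trans to ≤-trans; reflexive to ≤-reflexive; antisym to ≤-antisym)

  -- An order-theoretic calculus in which x ∧ a ≤ b plays the role of a sequent
  -- with context x and newest hypothesis a.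

  private variable
    a b d x y : Carrier

  curry≤ : x ∧ a ≤ b → x ≤ a ⇨ b
  curry≤ = to (⇨-residual _ _ _)

  eval≤ : (a ⇨ b) ∧ a ≤ b
  eval≤ = from (⇨-residual _ _ _) ≤-refl

  apply≤ : x ≤ a ⇨ b → x ≤ a → x ≤ b
  apply≤ f e = ≤-trans (∧-greatest f e) eval≤

  hyp≤ : x ∧ a ≤ a
  hyp≤ = x∧y≤y _ _

  weaken≤ : x ≤ y → x ∧ a ≤ y
  weaken≤ = ≤-trans (x∧y≤x _ _)

  cases≤ : x ≤ a ∨ b → x ∧ a ≤ d → x ∧ b ≤ d → x ≤ d
  cases≤ e f g = apply≤ (≤-trans e (∨-least (curry≤ (reorder f)) (curry≤ (reorder g)))) ≤-refl
    where
    reorder : x ∧ a ≤ d → a ∧ x ≤ d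
    reorder = ≤-trans (∧-greatest (x∧y≤y _ _) (x∧y≤x _ _))

  excluded≤ : a ≤ b ∨ (a ⊸ b)
  excluded≤ = from (⊸-residual _ _ _) ≤-refl

  ≈⊤⇔⊤≤ : (x ≈ ⊤) ⇔ (⊤ ≤ x)
  ≈⊤⇔⊤≤ = mk⇔ (λ e → ≤-reflexive (≈-sym e)) (≤-antisym (⊤-max _))

  ≤⇔⊤≤⇨ : (x ≤ y) ⇔ (⊤ ≤ x ⇨ y)
  ≤⇔⊤≤⇨ {x} = mk⇔ (λ x≤y → curry≤ (≤-trans hyp≤ x≤y))
                   (λ ⊤≤x⇨y → apply≤ (≤-trans (⊤-max x) ⊤≤x⇨y) ≤-refl)

  ≈⇔biimplication≈⊤ : (x ≈ y) ⇔ ((x ⇨ y) ∧ (y ⇨ x) ≈ ⊤)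
  ≈⇔biimplication≈⊤ = mk⇔
    (λ e → from ≈⊤⇔⊤≤ (∧-greatest (to ≤⇔⊤≤⇨ (≤-reflexive e)) (to ≤⇔⊤≤⇨ (≤-reflexive (≈-sym e)))))
    (λ e → ≤-antisym (from ≤⇔⊤≤⇨ (≤-trans (to ≈⊤⇔⊤≤ e) (x∧y≤x _ _)))
                     (from ≤⇔⊤≤⇨ (≤-trans (to ≈⊤⇔⊤≤ e) (x∧y≤y _ _))))

  module _ (v : Prop → Carrier) where

    axiom-valid : Axiom φ → ⊤ ≤ ⟦ A ⟧ φ v
    axiom-valid (A1 _ _)    = curry≤ (curry≤ (weaken≤ hyp≤))
    axiom-valid (A2 _ _ _)  = curry≤ (curry≤ (curry≤
      (apply≤ (apply≤ (weaken≤ (weaken≤ hyp≤)) hyp≤) (apply≤ (weaken≤ hyp≤) hyp≤))))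
    axiom-valid (A3 _ _)    = curry≤ (≤-trans hyp≤ (x≤x∨y _ _))
    axiom-valid (A4 _ _)    = curry≤ (≤-trans hyp≤ (y≤x∨y _ _))
    axiom-valid (A5 _ _ _)  = curry≤ (curry≤ (curry≤
      (cases≤ hyp≤ (apply≤ (weaken≤ (weaken≤ (weaken≤ hyp≤))) hyp≤)
                   (apply≤ (weaken≤ (weaken≤ hyp≤)) hyp≤))))
    axiom-valid (A6 _ _)    = curry≤ (≤-trans hyp≤ (x∧y≤x _ _))
    axiom-valid (A7 _ _)    = curry≤ (≤-trans hyp≤ (x∧y≤y _ _))
    axiom-valid (A8 _ _ _)  = curry≤ (curry≤ (curry≤
      (∧-greatest (apply≤ (weaken≤ (weaken≤ hyp≤)) hyp≤) (apply≤ (weaken≤ hyp≤) hyp≤))))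
    axiom-valid (A9 _)      = curry≤ (≤-trans hyp≤ (⊥-min _))
    axiom-valid (A10 _)     = curry≤ (⊤-max _)
    axiom-valid (A11 _ _)   = curry≤ (≤-trans hyp≤ excluded≤)
    axiom-valid (A12 _ _)   = curry≤ (≤-trans hyp≤ (to (⊸-residual _ _ _)
      (cases≤ (≤-trans (⊤-max _) excluded≤)
              (≤-trans (apply≤ hyp≤ (x∧y≤x _ _)) (x≤x∨y _ _))
              (≤-trans hyp≤ (y≤x∨y _ _)))))
    axiom-valid (A13 _ _ _) = curry≤ (≤-trans hyp≤ (to (⊸-residual _ _ _) (to (⊸-residual _ _ _)
      (≤-trans excluded≤ (∨-least (∨-least (x≤x∨y _ _) (≤-trans (x≤x∨y _ _) (y≤x∨y _ _)))
                                  (≤-trans (y≤x∨y _ _) (y≤x∨y _ _)))))))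
    axiom-valid (A14 _ _)   = curry≤ (curry≤
      (cases≤ (≤-trans hyp≤ excluded≤) hyp≤ (≤-trans (apply≤ (weaken≤ (weaken≤ hyp≤)) hyp≤) (⊥-min _))))

    soundness : (∀ γ → Γ γ → ⊤ ≤ ⟦ A ⟧ γ v) → Γ ⊢s φ → ⊤ ≤ ⟦ A ⟧ φ v
    soundness Γ-valid (ax a)  = axiom-valid a
    soundness Γ-valid (el γ)  = Γ-valid _ γ
    soundness Γ-valid (mp d e) = apply≤ (soundness Γ-valid e) (soundness Γ-valid d)
    soundness Γ-valid (sdn d) = curry≤ (≤-trans hyp≤ (to (⊸-residual _ _ _)
      (≤-trans (soundness Γ-valid d) (x≤x∨y _ _))))

module _ {c ℓ : Level} where

  soundness : Γ ⊢s φ → τS Γ ⊨[ c , ℓ ] (φ , ⊤f)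
  soundness {Γ} d A v Γ-true = from ≈⊤⇔⊤≤ (Semantics.soundness A v Γ-valid d)
    where
    open BHA A using (⊤; _≤_)
    open Semantics A using (≈⊤⇔⊤≤)
    Γ-valid : ∀ γ → Γ γ → ⊤ ≤ ⟦ A ⟧ γ v
    Γ-valid γ γ∈Γ = to ≈⊤⇔⊤≤ (Γ-true γ ⊤f (γ , γ∈Γ , refl))

  completeness : τS Γ ⊨[ c , ℓ ] (φ , ⊤f) → Γ ⊢s φ
  completeness {Γ} H = from ⊢⇔⊢⇔⊤f (to canonical-≈⇔≋ (H algebra canonical Γ-true))
    where
    open Lindenbaum Γ c ℓ
    open BHA algebra using (_≈_)
    Γ-true : ∀ θ η → τS Γ (θ , η) → ⟦ algebra ⟧ θ canonical ≈ ⟦ algebra ⟧ η canonical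
    Γ-true _ _ (γ , γ∈Γ , refl) = from canonical-≈⇔≋ (to ⊢⇔⊢⇔⊤f (el γ∈Γ))

  ⊢S⟨⟩⇔⊢s : (Γ ⊢S ⟨ φ ⟩) ⇔ (Γ ⊢s φ)
  ⊢S⟨⟩⇔⊢s = mk⇔ (λ d → d _ refl) (λ { d _ refl → d })

  ⊨S⟨⟩ₑ⇔⊨ : ∀ {Θ e} → (Θ ⊨S[ c , ℓ ] ⟨ e ⟩ₑ) ⇔ (Θ ⊨[ c , ℓ ] e)
  ⊨S⟨⟩ₑ⇔⊨ = mk⇔ (λ H → H _ refl) (λ { H _ refl → H })

  ⊢s⇔τ⊨τ : (Γ ⊢s φ) ⇔ (τS Γ ⊨S[ c , ℓ ] τ φ)
  ⊢s⇔τ⊨τ = ⇔-trans (mk⇔ soundness completeness) (⇔-sym ⊨S⟨⟩ₑ⇔⊨)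

  ⊨⇔τΔ⊨τΔ : ∀ {Θ ε δ} → (Θ ⊨[ c , ℓ ] (ε , δ)) ⇔ (τS (ΔS Θ) ⊨[ c , ℓ ] (ε ⇔f δ , ⊤f))
  ⊨⇔τΔ⊨τΔ = mk⇔
    (λ H A v Δ-true → to (≈⇔biimplication≈⊤ A)
       (H A v (λ θ η θ=η → from (≈⇔biimplication≈⊤ A) (Δ-true _ ⊤f (_ , ((θ , η) , θ=η , refl) , refl)))))
    (λ H A v Θ-true → from (≈⇔biimplication≈⊤ A)
       (H A v λ { _ _ (_ , ((θ , η) , θ=η , refl) , refl) → to (≈⇔biimplication≈⊤ A) (Θ-true θ η θ=η) }))
    where open Semantics using (≈⇔biimplication≈⊤)

  ⊨⇔ΔS⊢Δ : ∀ {Θ ε δ} → (Θ ⊨[ c , ℓ ] (ε , δ)) ⇔ (ΔS Θ ⊢S Δ ε δ)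
  ⊨⇔ΔS⊢Δ {ε = ε} {δ} =
    ⇔-trans (⊨⇔τΔ⊨τΔ {ε = ε} {δ})
    (⇔-trans (⇔-sym ⊨S⟨⟩ₑ⇔⊨)
    (⇔-trans (⇔-sym ⊢s⇔τ⊨τ)
             (⇔-sym ⊢S⟨⟩⇔⊢s)))

⟨⟩⊢ΔSτ : ⟨ φ ⟩ ⊢S ΔS (τ φ)
⟨⟩⊢ΔSτ _ (_ , refl , refl) = to ⊢⇔⊢⇔⊤f (el refl)

ΔSτ⊢⟨⟩ : ΔS (τ φ) ⊢S ⟨ φ ⟩
ΔSτ⊢⟨⟩ _ refl = from ⊢⇔⊢⇔⊤f (el (_ , refl , refl))

module _ {c ℓ : Level} {ε δ : Formula} where

  open Semantics using (≈⇔biimplication≈⊤)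

  ⟨⟩ₑ⊨τSΔ : ⟨ (ε , δ) ⟩ₑ ⊨S[ c , ℓ ] τS (Δ ε δ)
  ⟨⟩ₑ⊨τSΔ _ (_ , refl , refl) A v ε=δ = to (≈⇔biimplication≈⊤ A) (ε=δ ε δ refl)

  τSΔ⊨⟨⟩ₑ : τS (Δ ε δ) ⊨S[ c , ℓ ] ⟨ (ε , δ) ⟩ₑ
  τSΔ⊨⟨⟩ₑ _ refl A v Δ-true = from (≈⇔biimplication≈⊤ A) (Δ-true _ ⊤f (_ , refl , refl))

mainTheorem2 : (c ℓ : Level) →
    (∀ (Γ : FSet) (φ : Formula) → (Γ ⊢s φ) ⇔ (τS Γ ⊨S[ c , ℓ ] τ φ))
    × (∀ (Θ : ESet) (ε δ : Formula) → (Θ ⊨[ c , ℓ ] (ε , δ)) ⇔ (ΔS Θ ⊢S Δ ε δ))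
    × (∀ (φ : Formula) → (⟨ φ ⟩ ⊢S ΔS (τ φ)) × (ΔS (τ φ) ⊢S ⟨ φ ⟩))
    × (∀ (ε δ : Formula) →
         (⟨ (ε , δ) ⟩ₑ ⊨S[ c , ℓ ] τS (Δ ε δ)) × (τS (Δ ε δ) ⊨S[ c , ℓ ] ⟨ (ε , δ) ⟩ₑ))
mainTheorem2 c ℓ =
    (λ Γ φ → ⊢s⇔τ⊨τ)
  , (λ Θ ε δ → ⊨⇔ΔS⊢Δ)
  , (λ φ → ⟨⟩⊢ΔSτ , ΔSτ⊢⟨⟩)
  , (λ ε δ → ⟨⟩ₑ⊨τSΔ , τSΔ⊨⟨⟩ₑ)
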